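{- For all $m,n\in\mathbb{N}$, \[ \sum_{k=0}^{n}(-1)^k\binom{mn}{k}H_{mn-k}=\frac{(-1)^{n}}{m}\binom{mn}{n}\left[(m-1)H_{(m-1)n}-\frac{1}{mn}\right]. \]
   Context: $H_j=\sum_{i=1}^j\frac1i$ for $j\in\mathbb{N}_0$, with $H_0=0$. -}

module Defs where

open import Data.Nat using (ℕ; zero; suc)
open import Data.Integer using (+_)
open import Data.Rational using (ℚ; 0ℚ; 1ℚ; _+_; _*_; -_; _/_)

neg1^ : ℕ → ℚ
neg1^ zero    = 1ℚ
neg1^ (suc k) = - neg1^ k

H : ℕ → ℚ
H zero    = 0ℚ
H (suc j) = H j + (+ 1 / suc j)

sumTo : ℕ → (ℕ → ℚ) → ℚ
sumTo zero    f = f zero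
sumTo (suc n) f = sumTo n f + f (suc n)

module Submission where

-- For N ≥ 1 and n ≤ N the partial sums of the alternating sum have the closed form
--   Σ_{k≤n} (-1)^k C(N,k) H_{N-k} = (-1)^n [C(N-1,n) H_{N-n} - (C(N,n) - C(N-1,n))/N],
-- proved by induction on n with Pascal's rule and H_{N-n} = H_{N-n-1} + 1/(N-n); the inductive
-- step comes down to the absorption identity C(N-1,n)/(N-n) = C(N,n)/N. For N = mn the same
-- identity gives m C(N-1,n) = (m-1) C(N,n), and substituting this factors the closed form as stated.

module Binomial where

  open import Data.Nat using (suc; zero; _+_; _*_; _∸_)
  open import Data.Nat.Properties
    using (+-assoc; *-identityˡ; *-identityʳ; *-zeroʳ; *-distribˡ-+; *-distribʳ-∸; m+n∸m≡n; *-cancelˡ-≡)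
  open import Data.Nat.Combinatorics using (_C_; nC1≡n; nCk+nC[k+1]≡[n+1]C[k+1])
  open import Data.Nat.Tactic.RingSolver using (solve-∀)
  open import Relation.Binary.PropositionalEquality using (_≡_; sym; trans; cong; cong₂; module ≡-Reasoning)
  open ≡-Reasoning

  [k+1]*[n+1]C[k+1]≡[n+1]*nCk : ∀ n k → suc k * (suc n C suc k) ≡ suc n * (n C k)
  [k+1]*[n+1]C[k+1]≡[n+1]*nCk n zero = begin
    1 * (suc n C 1) ≡⟨ *-identityˡ _ ⟩
    suc n C 1       ≡⟨ nC1≡n (suc n) ⟩
    suc n           ≡⟨ *-identityʳ (suc n) ⟨
    suc n * 1       ∎
  [k+1]*[n+1]C[k+1]≡[n+1]*nCk zero (suc k) = *-zeroʳ (suc (suc k))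
  [k+1]*[n+1]C[k+1]≡[n+1]*nCk (suc n) (suc k) = begin
    suc (suc k) * (suc (suc n) C suc (suc k))
      ≡⟨ cong (suc (suc k) *_) (nCk+nC[k+1]≡[n+1]C[k+1] (suc n) (suc k)) ⟨
    suc (suc k) * (X + Y)
      ≡⟨ *-distribˡ-+ (suc (suc k)) X Y ⟩
    (X + suc k * X) + suc (suc k) * Y
      ≡⟨ +-assoc X (suc k * X) _ ⟩
    X + (suc k * X + suc (suc k) * Y)
      ≡⟨ cong (X +_) (cong₂ _+_ ([k+1]*[n+1]C[k+1]≡[n+1]*nCk n k) ([k+1]*[n+1]C[k+1]≡[n+1]*nCk n (suc k))) ⟩
    X + (suc n * (n C k) + suc n * (n C suc k))
      ≡⟨ cong (X +_) (*-distribˡ-+ (suc n) (n C k) (n C suc k)) ⟨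
    X + suc n * (n C k + n C suc k)
      ≡⟨ cong (λ t → X + suc n * t) (nCk+nC[k+1]≡[n+1]C[k+1] n k) ⟩
    X + suc n * X
      ∎
    where
    X = suc n C suc k
    Y = suc n C suc (suc k)

  [k+1]*nC[k+1]≡[n∸k]*nCk : ∀ n k → suc k * (n C suc k) ≡ (n ∸ k) * (n C k)
  [k+1]*nC[k+1]≡[n∸k]*nCk n k = begin
    suc k * (n C suc k)
      ≡⟨ m+n∸m≡n (suc k * (n C k)) _ ⟨
    (suc k * (n C k) + suc k * (n C suc k)) ∸ suc k * (n C k)
      ≡⟨ cong (_∸ suc k * (n C k)) (*-distribˡ-+ (suc k) (n C k) (n C suc k)) ⟨
    suc k * (n C k + n C suc k) ∸ suc k * (n C k)
      ≡⟨ cong (λ t → suc k * t ∸ suc k * (n C k)) (nCk+nC[k+1]≡[n+1]C[k+1] n k) ⟩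
    suc k * (suc n C suc k) ∸ suc k * (n C k)
      ≡⟨ cong (_∸ suc k * (n C k)) ([k+1]*[n+1]C[k+1]≡[n+1]*nCk n k) ⟩
    suc n * (n C k) ∸ suc k * (n C k)
      ≡⟨ *-distribʳ-∸ (n C k) (suc n) (suc k) ⟨
    (n ∸ k) * (n C k)
      ∎

  [n+1∸k]*[n+1]Ck≡[n+1]*nCk : ∀ n k → (suc n ∸ k) * (suc n C k) ≡ suc n * (n C k)
  [n+1∸k]*[n+1]Ck≡[n+1]*nCk n k =
    trans (sym ([k+1]*nC[k+1]≡[n∸k]*nCk (suc n) k)) ([k+1]*[n+1]C[k+1]≡[n+1]*nCk n k)

  [m+1]*[N∸1]Cn≡m*NCn : ∀ m n → let N = suc m * suc n in
                        suc m * ((N ∸ 1) C suc n) ≡ m * (N C suc n)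
  [m+1]*[N∸1]Cn≡m*NCn m n = *-cancelˡ-≡ _ _ (suc n) (begin
    suc n * (suc m * a)       ≡⟨ reassocˡ m n a ⟩
    suc (n + m * suc n) * a   ≡⟨ [n+1∸k]*[n+1]Ck≡[n+1]*nCk (n + m * suc n) (suc n) ⟨
    (n + m * suc n ∸ n) * c   ≡⟨ cong (_* c) (m+n∸m≡n n (m * suc n)) ⟩
    m * suc n * c             ≡⟨ reassocʳ m n c ⟩
    suc n * (m * c)           ∎)
    where
    a = (n + m * suc n) C suc n
    c = suc (n + m * suc n) C suc n
    reassocˡ : ∀ m n a → suc n * (suc m * a) ≡ suc (n + m * suc n) * a
    reassocˡ = solve-∀
    reassocʳ : ∀ m n c → m * suc n * c ≡ suc n * (m * c)
    reassocʳ = solve-∀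

open Binomial

open import Defs
open import Data.Nat using (ℕ; zero; suc; NonZero; _∸_; z≤n; s≤s; _≤_) renaming (_+_ to _+ℕ_; _*_ to _*ℕ_)
open import Data.Nat.Properties using (m*n≢0; m≤n⇒m≤1+n; m≤m+n; +-∸-assoc; m+n∸m≡n)
open import Data.Nat.Combinatorics using (_C_; nCk+nC[k+1]≡[n+1]C[k+1])
open import Data.Integer using (+_)
import Data.Integer as ℤ
import Data.Integer.Tactic.RingSolver as ℤ-Solver
open import Data.Rational using (ℚ; 0ℚ; 1ℚ; _+_; _*_; _-_; -_; _/_; toℚᵘ)
open import Data.Rational.Properties
  using ( _≟_; +-identityˡ; +-assoc; *-zeroˡ; *-identityˡ; *-identityʳ; *-distribʳ-+; +-*-commutativeRing
        ; toℚᵘ-injective; toℚᵘ-fromℚᵘ; toℚᵘ-homo-+; toℚᵘ-homo-*)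
open import Data.Rational.Unnormalised using (mkℚᵘ; *≡*)
import Data.Rational.Unnormalised as ℚᵘ
import Data.Rational.Unnormalised.Properties as ℚᵘ
open import Data.List using ([]; _∷_)
open import Level using (0ℓ)
open import Relation.Nullary.Decidable using (dec⇒maybe)
open import Tactic.RingSolver using (solve)
open import Tactic.RingSolver.Core.AlmostCommutativeRing using (AlmostCommutativeRing; fromCommutativeRing)
open import Relation.Binary.PropositionalEquality using (_≡_; sym; trans; cong; cong₂; module ≡-Reasoning)

fromℕ : ℕ → ℚ
fromℕ n = + n / 1

toℚᵘ-fromℕ : ∀ n → toℚᵘ (fromℕ n) ℚᵘ.≃ mkℚᵘ (+ n) 0
toℚᵘ-fromℕ n = toℚᵘ-fromℚᵘ (mkℚᵘ (+ n) 0)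

fromℕ-suc : ∀ n → fromℕ (suc n) ≡ 1ℚ + fromℕ n
fromℕ-suc n = toℚᵘ-injective (begin
  toℚᵘ (fromℕ (suc n))          ≈⟨ toℚᵘ-fromℕ (suc n) ⟩
  mkℚᵘ (+ suc n) 0              ≈⟨ *≡* (cross-multiplied (+ n)) ⟩
  ℚᵘ.1ℚᵘ ℚᵘ.+ mkℚᵘ (+ n) 0       ≈⟨ ℚᵘ.+-congʳ ℚᵘ.1ℚᵘ (toℚᵘ-fromℕ n) ⟨
  toℚᵘ 1ℚ ℚᵘ.+ toℚᵘ (fromℕ n)   ≈⟨ toℚᵘ-homo-+ 1ℚ (fromℕ n) ⟨
  toℚᵘ (1ℚ + fromℕ n)           ∎)
  where
  open ℚᵘ.≃-Reasoning
  cross-multiplied : ∀ i → (+ 1 ℤ.+ i) ℤ.* (+ 1 ℤ.* + 1) ≡ (+ 1 ℤ.* + 1 ℤ.+ i ℤ.* + 1) ℤ.* + 1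
  cross-multiplied = ℤ-Solver.solve-∀

fromℕ-homo-+ : ∀ m n → fromℕ (m +ℕ n) ≡ fromℕ m + fromℕ n
fromℕ-homo-+ zero    n = sym (+-identityˡ (fromℕ n))
fromℕ-homo-+ (suc m) n = begin
  fromℕ (suc (m +ℕ n))       ≡⟨ fromℕ-suc (m +ℕ n) ⟩
  1ℚ + fromℕ (m +ℕ n)        ≡⟨ cong (_+_ 1ℚ) (fromℕ-homo-+ m n) ⟩
  1ℚ + (fromℕ m + fromℕ n)   ≡⟨ +-assoc 1ℚ (fromℕ m) (fromℕ n) ⟨
  (1ℚ + fromℕ m) + fromℕ n   ≡⟨ cong (_+ fromℕ n) (fromℕ-suc m) ⟨
  fromℕ (suc m) + fromℕ n    ∎
  where open ≡-Reasoning

fromℕ-homo-* : ∀ m n → fromℕ (m *ℕ n) ≡ fromℕ m * fromℕ n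
fromℕ-homo-* zero    n = sym (*-zeroˡ (fromℕ n))
fromℕ-homo-* (suc m) n = begin
  fromℕ (n +ℕ m *ℕ n)                ≡⟨ fromℕ-homo-+ n (m *ℕ n) ⟩
  fromℕ n + fromℕ (m *ℕ n)           ≡⟨ cong (_+_ (fromℕ n)) (fromℕ-homo-* m n) ⟩
  fromℕ n + fromℕ m * fromℕ n        ≡⟨ cong (_+ fromℕ m * fromℕ n) (*-identityˡ (fromℕ n)) ⟨
  1ℚ * fromℕ n + fromℕ m * fromℕ n   ≡⟨ *-distribʳ-+ (fromℕ n) 1ℚ (fromℕ m) ⟨
  (1ℚ + fromℕ m) * fromℕ n           ≡⟨ cong (_* fromℕ n) (fromℕ-suc m) ⟨
  fromℕ (suc m) * fromℕ n            ∎
  where open ≡-Reasoning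

fromℕ-*-≡ : ∀ {a b c d} → a *ℕ b ≡ c *ℕ d → fromℕ a * fromℕ b ≡ fromℕ c * fromℕ d
fromℕ-*-≡ {a} {b} {c} {d} eq = trans (sym (fromℕ-homo-* a b)) (trans (cong fromℕ eq) (fromℕ-homo-* c d))

fromℕ[1+n]*1/[1+n]≡1 : ∀ n → fromℕ (suc n) * (+ 1 / suc n) ≡ 1ℚ
fromℕ[1+n]*1/[1+n]≡1 n = toℚᵘ-injective (begin
  toℚᵘ (fromℕ (suc n) * (+ 1 / suc n))           ≈⟨ toℚᵘ-homo-* (fromℕ (suc n)) (+ 1 / suc n) ⟩
  toℚᵘ (fromℕ (suc n)) ℚᵘ.* toℚᵘ (+ 1 / suc n)   ≈⟨ ℚᵘ.*-cong (toℚᵘ-fromℕ (suc n)) (toℚᵘ-fromℚᵘ (mkℚᵘ (+ 1) n)) ⟩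
  mkℚᵘ (+ suc n) 0 ℚᵘ.* mkℚᵘ (+ 1) n             ≈⟨ *≡* (cross-multiplied (+ suc n)) ⟩
  ℚᵘ.1ℚᵘ                                         ∎)
  where
  open ℚᵘ.≃-Reasoning
  cross-multiplied : ∀ i → (i ℤ.* + 1) ℤ.* + 1 ≡ + 1 ℤ.* (+ 1 ℤ.* i)
  cross-multiplied = ℤ-Solver.solve-∀

ℚ-ring : AlmostCommutativeRing 0ℓ 0ℓ
ℚ-ring = fromCommutativeRing +-*-commutativeRing (λ p → dec⇒maybe (0ℚ ≟ p))

p*a≡q*b⇒a*q⁻¹≡b*p⁻¹ : ∀ {p p⁻¹ q q⁻¹} a b → p * p⁻¹ ≡ 1ℚ → q * q⁻¹ ≡ 1ℚ →
                      p * a ≡ q * b → a * q⁻¹ ≡ b * p⁻¹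
p*a≡q*b⇒a*q⁻¹≡b*p⁻¹ {p} {p⁻¹} {q} {q⁻¹} a b p*p⁻¹≡1 q*q⁻¹≡1 p*a≡q*b = begin
  a * q⁻¹               ≡⟨ *-identityʳ (a * q⁻¹) ⟨
  a * q⁻¹ * 1ℚ          ≡⟨ cong (_*_ (a * q⁻¹)) p*p⁻¹≡1 ⟨
  a * q⁻¹ * (p * p⁻¹)   ≡⟨ solve (a ∷ p ∷ p⁻¹ ∷ q⁻¹ ∷ []) ℚ-ring ⟩
  p * a * (p⁻¹ * q⁻¹)   ≡⟨ cong (_* (p⁻¹ * q⁻¹)) p*a≡q*b ⟩
  q * b * (p⁻¹ * q⁻¹)   ≡⟨ solve (b ∷ q ∷ p⁻¹ ∷ q⁻¹ ∷ []) ℚ-ring ⟩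
  b * p⁻¹ * (q * q⁻¹)   ≡⟨ cong (_*_ (b * p⁻¹)) q*q⁻¹≡1 ⟩
  b * p⁻¹ * 1ℚ          ≡⟨ *-identityʳ (b * p⁻¹) ⟩
  b * p⁻¹               ∎
  where open ≡-Reasoning

closed-form-step : ∀ ε a b c h u x → a * u ≡ c * x →
  ε * (a * (h + u) - (c - a) * x) + - ε * ((a + b) * h) ≡ - ε * (b * h - ((a + b) - b) * x)
closed-form-step ε a b c h u x a*u≡c*x = begin
  ε * (a * (h + u) - (c - a) * x) + - ε * ((a + b) * h)
    ≡⟨ solve (ε ∷ a ∷ b ∷ c ∷ h ∷ u ∷ x ∷ []) ℚ-ring ⟩
  - ε * (b * h - ((a + b) - b) * x) + (ε * (a * u) - ε * (c * x))
    ≡⟨ cong (λ t → - ε * (b * h - ((a + b) - b) * x) + (ε * t - ε * (c * x))) a*u≡c*x ⟩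
  - ε * (b * h - ((a + b) - b) * x) + (ε * (c * x) - ε * (c * x))
    ≡⟨ solve (ε ∷ a ∷ b ∷ c ∷ h ∷ x ∷ []) ℚ-ring ⟩
  - ε * (b * h - ((a + b) - b) * x)
    ∎
  where open ≡-Reasoning

closed-form-factorised : ∀ ε μ a c h v x → (1ℚ + μ) * v ≡ 1ℚ → (1ℚ + μ) * a ≡ μ * c →
  ε * (a * h - (c - a) * x) ≡ (ε * v) * (c * (μ * h - x))
closed-form-factorised ε μ a c h v x [1+μ]v≡1 [1+μ]a≡μc = begin
  ε * (a * h - (c - a) * x)
    ≡⟨ *-identityʳ _ ⟨
  ε * (a * h - (c - a) * x) * 1ℚ
    ≡⟨ cong (_*_ (ε * (a * h - (c - a) * x))) [1+μ]v≡1 ⟨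
  ε * (a * h - (c - a) * x) * ((1ℚ + μ) * v)
    ≡⟨ solve (ε ∷ μ ∷ a ∷ c ∷ h ∷ v ∷ x ∷ []) ℚ-ring ⟩
  (ε * v) * ((1ℚ + μ) * a * (h + x) - (1ℚ + μ) * c * x)
    ≡⟨ cong (λ t → (ε * v) * (t * (h + x) - (1ℚ + μ) * c * x)) [1+μ]a≡μc ⟩
  (ε * v) * (μ * c * (h + x) - (1ℚ + μ) * c * x)
    ≡⟨ solve (ε ∷ μ ∷ c ∷ h ∷ v ∷ x ∷ []) ℚ-ring ⟩
  (ε * v) * (c * (μ * h - x))
    ∎
  where open ≡-Reasoning

partial-sum-closed-form : ∀ M n → n ≤ suc M →
  sumTo n (λ k → neg1^ k * (fromℕ (suc M C k) * H (suc M ∸ k)))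
    ≡ neg1^ n * (fromℕ (M C n) * H (suc M ∸ n) - (fromℕ (suc M C n) - fromℕ (M C n)) * (+ 1 / suc M))
partial-sum-closed-form M zero z≤n = base (H (suc M)) (+ 1 / suc M)
  where
  base : ∀ h x → 1ℚ * (1ℚ * h) ≡ 1ℚ * (1ℚ * h - (1ℚ - 1ℚ) * x)
  base h x = solve (h ∷ x ∷ []) ℚ-ring
partial-sum-closed-form M (suc n) (s≤s n≤M) = begin
  sumTo n t + t (suc n)
    ≡⟨ cong (_+ t (suc n)) (partial-sum-closed-form M n (m≤n⇒m≤1+n n≤M)) ⟩
  ε * (a * H (suc M ∸ n) - (c - a) * x) + - ε * (fromℕ (suc M C suc n) * H d)
    ≡⟨ cong₂ (λ s r → ε * (a * H s - (c - a) * x) + - ε * (r * H d)) (+-∸-assoc 1 n≤M) pascal ⟩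
  ε * (a * H (suc d) - (c - a) * x) + - ε * ((a + b) * H d)
    ≡⟨ closed-form-step ε a b c (H d) (+ 1 / suc d) x absorption ⟩
  - ε * (b * H d - ((a + b) - b) * x)
    ≡⟨ cong (λ r → - ε * (b * H d - (r - b) * x)) pascal ⟨
  - ε * (b * H d - (fromℕ (suc M C suc n) - b) * x)
    ∎
  where
  open ≡-Reasoning
  t : ℕ → ℚ
  t k = neg1^ k * (fromℕ (suc M C k) * H (suc M ∸ k))
  ε = neg1^ n
  a = fromℕ (M C n)
  b = fromℕ (M C suc n)
  c = fromℕ (suc M C n)
  d = M ∸ n
  x = + 1 / suc M
  pascal : fromℕ (suc M C suc n) ≡ a + b
  pascal = trans (cong fromℕ (sym (nCk+nC[k+1]≡[n+1]C[k+1] M n))) (fromℕ-homo-+ (M C n) (M C suc n))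
  absorption : a * (+ 1 / suc d) ≡ c * x
  absorption = p*a≡q*b⇒a*q⁻¹≡b*p⁻¹ {fromℕ (suc M)} {x} {fromℕ (suc d)} a c
    (fromℕ[1+n]*1/[1+n]≡1 M) (fromℕ[1+n]*1/[1+n]≡1 d)
    (fromℕ-*-≡ {suc M} {M C n} {suc d} {suc M C n} (trans (sym ([n+1∸k]*[n+1]Ck≡[n+1]*nCk M n)) (cong (_*ℕ (suc M C n)) (+-∸-assoc 1 n≤M))))

mainTheorem17 : (m n : ℕ) → .{{_ : NonZero m}} → .{{_ : NonZero n}} →
    sumTo n (λ k → neg1^ k * ((+ ((m *ℕ n) C k) / 1) * H ((m *ℕ n) ∸ k)))
    ≡ (neg1^ n * (+ 1 / m)) * ((+ ((m *ℕ n) C n) / 1)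
    * ((+ (m ∸ 1) / 1) * H ((m ∸ 1) *ℕ n) - (+ 1 / (m *ℕ n)) {{m*n≢0 m n}}))
mainTheorem17 (suc m) (suc n) = begin
  sumTo (suc n) (λ k → neg1^ k * (fromℕ (suc M C k) * H (suc M ∸ k)))
    ≡⟨ partial-sum-closed-form M (suc n) (s≤s (m≤m+n n (m *ℕ suc n))) ⟩
  ε * (a * H (M ∸ n) - (c - a) * x)
    ≡⟨ cong (λ j → ε * (a * H j - (c - a) * x)) (m+n∸m≡n n (m *ℕ suc n)) ⟩
  ε * (a * H (m *ℕ suc n) - (c - a) * x)
    ≡⟨ closed-form-factorised ε (fromℕ m) a c (H (m *ℕ suc n)) (+ 1 / suc m) x
         (trans (cong (_* (+ 1 / suc m)) (sym (fromℕ-suc m))) (fromℕ[1+n]*1/[1+n]≡1 m))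
         (trans (cong (_* a) (sym (fromℕ-suc m))) (fromℕ-*-≡ {suc m} {M C suc n} {m} {suc M C suc n} ([m+1]*[N∸1]Cn≡m*NCn m n))) ⟩
  (ε * (+ 1 / suc m)) * (c * (fromℕ m * H (m *ℕ suc n) - x))
    ∎
  where
  open ≡-Reasoning
  M = n +ℕ m *ℕ suc n
  ε = neg1^ (suc n)
  a = fromℕ (M C suc n)
  c = fromℕ (suc M C suc n)
  x = + 1 / suc M
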